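{- Let $r\ge2$ be an integer. If $G$ is a bipartite graph all of whose vertex degrees lie in $\{2r-3,2r-2,2r-1,2r\}$, then $\mathrm{def}_c(G)\le|V_{2r-3}|$, where $V_{2r-3}$ is the set of vertices of degree $2r-3$ in $G$.
   Context: All graphs are finite, simple and undirected. A set $A\subseteq\{1,\dots,t\}$ is a cyclic interval modulo $t$ if $A$ or $\{1,\dots,t\}\setminus A$ is an interval of integers; a cyclic interval $t$-coloring is a proper edge coloring with colors $1,\dots,t$ in which the set of colors at every vertex is a cyclic interval modulo $t$. The cyclic deficiency $\mathrm{def}_c(G)$ is the minimum number of pendant edges whose attachment to $G$ yields a graph admitting a cyclic interval coloring. -}

module Defs where

open import Data.Nat using (ℕ; zero; suc; _+_; _*_; _∸_; _≤_; _≟_)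
open import Data.Bool using (Bool; true; false; if_then_else_; _∧_)
open import Data.Fin using (Fin; splitAt)
open import Data.Fin.Properties using () renaming (_≟_ to _≟ᶠ_)
open import Data.List using (List; length; filter; map; allFin)
open import Data.Nat.ListAction using (sum)
open import Data.Sum using (_⊎_; inj₁; inj₂)
open import Data.Product using (Σ; ∃; ∃-syntax; _×_; _,_)
open import Relation.Nullary using (¬_; does)
open import Relation.Binary.PropositionalEquality using (_≡_; _≢_)
open import Function.Bundles using (_⇔_)

record Graph : Set where
  field
    n     : ℕ
    adj   : Fin n → Fin n → Bool
    sym   : ∀ u v → adj u v ≡ adj v u
    irrfl : ∀ u → adj u u ≡ false
open Graph public

deg : (G : Graph) → Fin (n G) → ℕ
deg G u = sum (map (λ v → if adj G u v then 1 else 0) (allFin (n G)))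

countDeg : (G : Graph) → ℕ → ℕ
countDeg G d = length (filter (λ v → deg G v ≟ d) (allFin (n G)))

Bipartite : Graph → Set
Bipartite G = Σ (Fin (n G) → Bool) λ side →
  ∀ u v → adj G u v ≡ true → side u ≢ side v

IsInterval : (ℕ → Set) → Set
IsInterval A = Σ ℕ λ a → Σ ℕ λ b → ∀ x → A x ⇔ (a ≤ x × x ≤ b)

IsCyclicInterval : ℕ → (ℕ → Set) → Set
IsCyclicInterval t A =
  IsInterval A ⊎ IsInterval (λ x → (1 ≤ x × x ≤ t) × ¬ A x)

ColoursAt : (G : Graph) → (Fin (n G) → Fin (n G) → ℕ) → Fin (n G) → ℕ → Set
ColoursAt G c u x = ∃[ v ] (adj G u v ≡ true × c u v ≡ x)

-- cyclic interval t-colouring: proper edge colouring with colours 1,…,t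
-- (c u v is the colour of the edge uv; values on non-edges are irrelevant)
-- such that the colour set at every vertex is a cyclic interval modulo t
IsCyclicIntervalColouring : (G : Graph) → ℕ → (Fin (n G) → Fin (n G) → ℕ) → Set
IsCyclicIntervalColouring G t c =
  (∀ u v → adj G u v ≡ true → c u v ≡ c v u) ×
  (∀ u v → adj G u v ≡ true → 1 ≤ c u v × c u v ≤ t) ×
  (∀ u v w → adj G u v ≡ true → adj G u w ≡ true → v ≢ w → c u v ≢ c u w) ×
  (∀ u → IsCyclicInterval t (ColoursAt G c u))

HasCyclicIntervalColouring : Graph → Set
HasCyclicIntervalColouring G =
  ∃[ t ] ∃[ c ] IsCyclicIntervalColouring G t c

-- Attaching k pendant edges to G: new vertices Fin k (indices n,…,n+k-1),
-- the j-th new vertex is adjacent exactly to the old vertex f j.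
pendAdj : (G : Graph) (k : ℕ) (f : Fin k → Fin (n G)) →
          Fin (n G + k) → Fin (n G + k) → Bool
pendAdj G k f x y with splitAt (n G) x | splitAt (n G) y
... | inj₁ u | inj₁ v = adj G u v
... | inj₁ u | inj₂ j = does (f j ≟ᶠ u)
... | inj₂ j | inj₁ u = does (f j ≟ᶠ u)
... | inj₂ i | inj₂ j = false

private
  pendSym : (G : Graph) (k : ℕ) (f : Fin k → Fin (n G)) →
            ∀ x y → pendAdj G k f x y ≡ pendAdj G k f y x
  pendSym G k f x y with splitAt (n G) x | splitAt (n G) y
  ... | inj₁ u | inj₁ v = sym G u v
  ... | inj₁ u | inj₂ j = Relation.Binary.PropositionalEquality.refl
  ... | inj₂ j | inj₁ u = Relation.Binary.PropositionalEquality.refl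
  ... | inj₂ i | inj₂ j = Relation.Binary.PropositionalEquality.refl

  pendIrr : (G : Graph) (k : ℕ) (f : Fin k → Fin (n G)) →
            ∀ x → pendAdj G k f x x ≡ false
  pendIrr G k f x with splitAt (n G) x
  ... | inj₁ u = irrfl G u
  ... | inj₂ j = Relation.Binary.PropositionalEquality.refl

attachPendant : (G : Graph) (k : ℕ) → (Fin k → Fin (n G)) → Graph
attachPendant G k f = record
  { n = n G + k ; adj = pendAdj G k f ; sym = pendSym G k f ; irrfl = pendIrr G k f }

-- def_c(G) ≤ m : some attachment of at most m pendant edges to G yields a
-- graph admitting a cyclic interval colouring
DefcAtMost : Graph → ℕ → Set
DefcAtMost G m = ∃[ k ] (k ≤ m × ∃[ f ] HasCyclicIntervalColouring (attachPendant G k f))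

-- Attach a pendant edge at every vertex of degree 2r − 3. The new graph is bipartite with all degrees in
-- {1, 2r − 2, 2r − 1, 2r}, and it has a cyclic interval 2r-colouring whose colours 0, …, 2r − 1 come in the
-- r pairs {2p, 2p + 1}. First label every edge 0 or 1 so that each label occurs at most ⌈d(v)/2⌉ times at
-- every vertex v: split each vertex into copies carrying two consecutive edges and properly 2-colour the
-- resulting graph of maximum degree 2. Then let H have vertices (v, i), an edge (v, i)(w, i) for every edge
-- vw of label i, and an edge (v, 0)(v, 1) for every vertex v of degree 2r − 2. H is bipartite of maximum
-- degree r, so by König's theorem it has a proper r-colouring p, and the edge vw gets colour 2p + i. A vertex
-- of degree 2r − 2 then misses exactly the pair of colours of its edge in H, a vertex of degree 2r − 1 or 2r
-- misses at most one colour and a leaf carries a single one, so every colour set is a cyclic interval.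
-- König's theorem is proved by induction on the number of edges with the usual Kempe-chain recolouring.

module Submission where

open import Defs hiding (sym)
open import Data.Bool using (Bool; true; false; not; _∧_; _∨_; if_then_else_) renaming (_≟_ to _≟ᵇ_)
open import Data.Bool.Properties
  using (¬-not; not-involutive; not-injective; not-¬; ∧-identityʳ; ∧-zeroʳ; ∧-comm; ∨-comm)
open import Data.Empty using (⊥; ⊥-elim)
open import Data.Fin using (Fin; zero; suc; toℕ; fromℕ<; combine; remQuot; splitAt; join; _↑ˡ_; _↑ʳ_)
  renaming (_<_ to _<ᶠ_)
open import Data.Fin.Permutation.Components using (transpose; transpose-inverse)
open import Data.Fin.Properties
  using (any?; suc-injective; 0≢1+n; _<?_; <-cmp; toℕ<n; toℕ-fromℕ<; toℕ-injective; fromℕ<-injective;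
         remQuot-combine; combine-remQuot; combine-injective; combine-injectiveˡ; combine-injectiveʳ; toℕ-combine;
         splitAt-join; join-splitAt)
  renaming (_≟_ to _≟ᶠ_; <-irrefl to <ᶠ-irrefl; <-trans to <ᶠ-trans)
open import Data.List using (filter; length; tabulate)
open import Data.List.Properties using (map-tabulate)
open import Data.Nat using (ℕ; zero; suc; pred; _+_; _*_; _∸_; _≤_; _<_; z≤n; s≤s; z<s; s≤s⁻¹; _≟_;
  NonZero; >-nonZero; >-nonZero⁻¹; ⌈_/2⌉; ⌊_/2⌋)
open import Data.Nat.DivMod using (_/_; _%_; m≡m%n+[m/n]*n; m%n<n; m/n≤m; m<n*o⇒m/o<n)
open import Data.Nat.ListAction using (sum)
open import Data.Nat.Properties
  using (module ≤-Reasoning; ≤-refl; ≤-reflexive; ≤-trans; ≤-antisym; <-≤-trans; ≤-<-trans; <⇒≱; <⇒≢;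
         <-irrefl; n≤1+n; n<1+n; m≤m+n; m≤n⇒m<n∨m≡n; +-suc; +-assoc; +-comm; +-identityʳ; *-comm; +-monoʳ-≤;
         +-monoˡ-≤; +-mono-≤; *-monoʳ-≤; +-cancelˡ-≡; +-cancelˡ-<; m∸n+n≡m; ⌊n/2⌋+⌈n/2⌉≡n; ⌊n/2⌋≤⌈n/2⌉;
         ⌈n/2⌉-mono; n≡⌈n+n/2⌉)
open import Data.Product using (Σ; ∃; _×_; _,_; proj₁; proj₂; uncurry)
open import Data.Sum using (_⊎_; inj₁; inj₂) renaming (map to map-⊎)
open import Function using (id; _∘_; _∘′_)
open import Function.Bundles using (_⇔_; mk⇔; module Equivalence)
open import Function.Properties.Equivalence using () renaming (sym to ⇔-sym)
open import Relation.Binary using (tri<; tri≈; tri>)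
open import Relation.Binary.PropositionalEquality
open import Relation.Nullary using (¬_; Dec; yes; no; does; contradiction)
open import Relation.Nullary.Decidable using (dec-true; dec-false)

private
  variable
    m k t : ℕ

-- Counting over Fin

∧-true : ∀ {a b} → a ∧ b ≡ true → a ≡ true × b ≡ true
∧-true {true} {true} refl = refl , refl

∧-intro : ∀ {a b} → a ≡ true → b ≡ true → a ∧ b ≡ true
∧-intro refl refl = refl

∨-true : ∀ {a b} → a ∨ b ≡ true → a ≡ true ⊎ b ≡ true
∨-true {true}          _ = inj₁ refl
∨-true {false} {true}  _ = inj₂ refl

∧-cong-if : ∀ {a b c} → (a ≡ true → b ≡ c) → a ∧ b ≡ a ∧ c
∧-cong-if {true}  b≡c = b≡c refl
∧-cong-if {false} _   = refl

infix 7 _==_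
_==_ : Fin m → Fin m → Bool
i == j = does (i ≟ᶠ j)

does⇒ : {A : Set} (a? : Dec A) → does a? ≡ true → A
does⇒ (yes a) _ = a

==⇒≡ : {i j : Fin m} → (i == j) ≡ true → i ≡ j
==⇒≡ {i = i} {j} = does⇒ (i ≟ᶠ j)

≡⇒== : {i j : Fin m} → i ≡ j → (i == j) ≡ true
≡⇒== {i = i} {j} = dec-true (i ≟ᶠ j)

≢⇒== : {i j : Fin m} → i ≢ j → (i == j) ≡ false
≢⇒== {i = i} {j} = dec-false (i ≟ᶠ j)

==-refl : (i : Fin m) → (i == i) ≡ true
==-refl i = dec-true (i ≟ᶠ i) refl

==-sym : (i j : Fin m) → (i == j) ≡ (j == i)
==-sym i j with i ≟ᶠ j
... | yes refl = sym (==-refl i)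
... | no  i≢j  = sym (≢⇒== (i≢j ∘ sym))

not-==⇒≢ : {i j : Fin m} → not (i == j) ≡ true → i ≢ j
not-==⇒≢ {i = i} p refl rewrite ==-refl i = contradiction p λ ()

exists? : (P : Fin m → Bool) → Dec (∃ λ i → P i ≡ true)
exists? P = any? (λ i → P i ≟ᵇ true)

exists-witness : (P : Fin m → Bool) → does (exists? P) ≡ true → ∃ λ i → P i ≡ true
exists-witness P p with exists? P
... | yes w = w

count : (Fin m → Bool) → ℕ
count {zero}  P = 0
count {suc m} P = (if P zero then 1 else 0) + count (P ∘ suc)

count-≤ : (P : Fin m → Bool) → count P ≤ m
count-≤ {zero}  P = z≤n
count-≤ {suc m} P with P zero
... | true  = s≤s (count-≤ (P ∘ suc))
... | false = ≤-trans (count-≤ (P ∘ suc)) (n≤1+n m)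

count-cong : {P Q : Fin m → Bool} → (∀ i → P i ≡ Q i) → count P ≡ count Q
count-cong {zero}  P≡Q = refl
count-cong {suc m} P≡Q = cong₂ (λ b c → (if b then 1 else 0) + c) (P≡Q zero) (count-cong (P≡Q ∘ suc))

count-true : count {m} (λ _ → true) ≡ m
count-true {zero}  = refl
count-true {suc m} = cong suc count-true

count-false : count {m} (λ _ → false) ≡ 0
count-false {zero}  = refl
count-false {suc m} = count-false {m}

_∖_ : (Fin m → Bool) → Fin m → Fin m → Bool
(P ∖ y) i = P i ∧ not (i == y)

∖-member : (P : Fin m → Bool) {x y : Fin m} → P x ≡ true → x ≢ y → (P ∖ y) x ≡ true
∖-member P Px x≢y rewrite Px | ≢⇒== x≢y = refl

count-remove : (P : Fin m → Bool) {y : Fin m} → P y ≡ true → count P ≡ suc (count (P ∖ y))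
count-remove {suc m} P {zero} Py rewrite Py = cong suc (count-cong λ i → sym (∧-identityʳ (P (suc i))))
count-remove {suc m} P {suc y} Py with P zero
... | true  = cong suc (count-remove (P ∘ suc) Py)
... | false = count-remove (P ∘ suc) Py

count-injection : (P : Fin m → Bool) (Q : Fin k → Bool) (g : ∀ i → P i ≡ true → Fin k) →
  (∀ i p → Q (g i p) ≡ true) → (∀ {i j} p q → g i p ≡ g j q → i ≡ j) → count P ≤ count Q
count-injection {zero}  P Q g g∈Q g-inj = z≤n
count-injection {suc m} P Q g g∈Q g-inj with P zero in P0
... | false = count-injection (P ∘ suc) Q (g ∘ suc) (g∈Q ∘ suc) λ p q eq → suc-injective (g-inj p q eq)
... | true  = begin
  suc (count (P ∘ suc))  ≤⟨ s≤s (count-injection (P ∘ suc) (Q ∖ y) (g ∘ suc) g∈Q∖y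
                                   λ p q eq → suc-injective (g-inj p q eq)) ⟩
  suc (count (Q ∖ y))    ≡⟨ count-remove Q (g∈Q zero P0) ⟨
  count Q                ∎
  where
  open ≤-Reasoning
  y = g zero P0
  g∈Q∖y : ∀ i p → (Q ∖ y) (g (suc i) p) ≡ true
  g∈Q∖y i p = ∖-member Q (g∈Q (suc i) p) λ eq → 0≢1+n (sym (g-inj p P0 eq))

count-mono : (P Q : Fin m → Bool) → (∀ i → P i ≡ true → Q i ≡ true) → count P ≤ count Q
count-mono P Q P⊆Q = count-injection P Q (λ i _ → i) P⊆Q λ _ _ i≡j → i≡j

count-mono-strict : (P Q : Fin m → Bool) {x : Fin m} → (∀ i → P i ≡ true → Q i ≡ true) →
  Q x ≡ true → P x ≡ false → count P < count Q
count-mono-strict P Q {x} P⊆Q Qx Px = begin-strict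
  count P        <⟨ s≤s (count-mono P (Q ∖ x) P⊆Q∖x) ⟩
  suc (count (Q ∖ x)) ≡⟨ count-remove Q Qx ⟨
  count Q        ∎
  where
  open ≤-Reasoning
  P⊆Q∖x : ∀ i → P i ≡ true → (Q ∖ x) i ≡ true
  P⊆Q∖x i Pi = ∖-member Q (P⊆Q i Pi) λ { refl → contradiction (trans (sym Pi) Px) λ () }

count-complement : (P : Fin m → Bool) → count P + count (not ∘ P) ≡ m
count-complement {zero}  P = refl
count-complement {suc m} P with P zero
... | true  = cong suc (count-complement (P ∘ suc))
... | false = trans (+-suc (count (P ∘ suc)) _) (cong suc (count-complement (P ∘ suc)))

count-↑ : ∀ m (P : Fin (m + k) → Bool) → count P ≡ count (P ∘ (_↑ˡ k)) + count (P ∘ (m ↑ʳ_))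
count-↑ zero    P = refl
count-↑ (suc m) P = trans (cong (first +_) (count-↑ m (P ∘ suc))) (sym (+-assoc first _ _))
  where first = if P zero then 1 else 0

count-∨ : (P Q : Fin m → Bool) → count (λ i → P i ∨ Q i) ≤ count P + count Q
count-∨ {zero}  P Q = z≤n
count-∨ {suc m} P Q with P zero | Q zero
... | true  | true  =
  s≤s (≤-trans (count-∨ (P ∘ suc) (Q ∘ suc)) (+-monoʳ-≤ (count (P ∘ suc)) (n≤1+n _)))
... | true  | false = s≤s (count-∨ (P ∘ suc) (Q ∘ suc))
... | false | true  = ≤-trans (s≤s (count-∨ (P ∘ suc) (Q ∘ suc))) (≤-reflexive (sym (+-suc _ _)))
... | false | false = count-∨ (P ∘ suc) (Q ∘ suc)

count-singleton : (x : Fin m) → count (x ==_) ≡ 1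
count-singleton {suc m} zero    = cong suc (count-false {m})
count-singleton {suc m} (suc x) = count-singleton x

member⇒count-pos : (P : Fin m → Bool) {x : Fin m} → P x ≡ true → 0 < count P
member⇒count-pos P Px rewrite count-remove P Px = z<s

count-pos⇒member : (P : Fin m → Bool) → 0 < count P → ∃ λ i → P i ≡ true
count-pos⇒member {m} P 0<count with exists? P
... | yes member = member
... | no ∄member = contradiction (trans (count-cong Pi≡false) (count-false {m})) (<⇒≱ 0<count ∘ ≤-reflexive)
  where
  Pi≡false : ∀ i → P i ≡ false
  Pi≡false i = ¬-not λ Pi → ∄member (i , Pi)

count-≤1-unique : (P : Fin m → Bool) → count P ≤ 1 →
  {x y : Fin m} → P x ≡ true → P y ≡ true → x ≡ y
count-≤1-unique P count≤1 {x} {y} Px Py with x ≟ᶠ y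
... | yes x≡y = x≡y
... | no  x≢y = contradiction count≤1 (<⇒≱ (begin-strict
  1                   <⟨ s≤s (member⇒count-pos (P ∖ x) (∖-member P Py (≢-sym x≢y))) ⟩
  suc (count (P ∖ x)) ≡⟨ count-remove P Px ⟨
  count P             ∎))
  where open ≤-Reasoning

count-≤2-cases : (P : Fin m → Bool) → count P ≤ 2 →
  {x y z : Fin m} → P x ≡ true → P y ≡ true → x ≢ y → P z ≡ true → z ≡ x ⊎ z ≡ y
count-≤2-cases P count≤2 {x} {y} {z} Px Py x≢y Pz with z ≟ᶠ x
... | yes z≡x = inj₁ z≡x
... | no  z≢x =
  inj₂ (count-≤1-unique (P ∖ x) count∖x≤1 (∖-member P Pz z≢x) (∖-member P Py (≢-sym x≢y)))
  where
  count∖x≤1 : count (P ∖ x) ≤ 1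
  count∖x≤1 = s≤s⁻¹ (≤-trans (≤-reflexive (sym (count-remove P Px))) count≤2)

-- Graphs and proper edge colourings

degree : (G : Graph) → Fin (n G) → ℕ
degree G v = count (adj G v)

sum-tabulate-indicator : (P : Fin m → Bool) → sum (tabulate (λ i → if P i then 1 else 0)) ≡ count P
sum-tabulate-indicator {zero}  P = refl
sum-tabulate-indicator {suc m} P =
  cong ((if P zero then 1 else 0) +_) (sum-tabulate-indicator (P ∘ suc))

deg≡degree : (G : Graph) (v : Fin (n G)) → deg G v ≡ degree G v
deg≡degree G v =
  trans (cong sum (map-tabulate id λ w → if adj G v w then 1 else 0)) (sum-tabulate-indicator (adj G v))

length-filter-tabulate : {A : Set} {P : A → Set} (P? : ∀ a → Dec (P a)) (f : Fin m → A) →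
  length (filter P? (tabulate f)) ≡ count (λ i → does (P? (f i)))
length-filter-tabulate {zero}  P? f = refl
length-filter-tabulate {suc m} P? f with does (P? (f zero))
... | true  = cong suc (length-filter-tabulate P? (f ∘ suc))
... | false = length-filter-tabulate P? (f ∘ suc)

bipartiteGraph : (E : Fin m → Fin m → Bool) → (∀ x y → E x y ≡ E y x) → (side : Fin m → Bool) →
  (∀ x y → E x y ≡ true → side x ≢ side y) → Σ Graph Bipartite
bipartiteGraph {m} E E-sym side E-bip =
  record { n = m ; adj = E ; sym = E-sym ; irrfl = λ x → ¬-not λ Exx → E-bip x x Exx refl } , side , E-bip

EdgeColouring : Graph → ℕ → Set
EdgeColouring G k = Fin (n G) → Fin (n G) → Fin k

IsProper : (G : Graph) → EdgeColouring G k → Set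
IsProper G κ = (∀ {x y} → adj G x y ≡ true → κ x y ≡ κ y x) ×
               (∀ {x y z} → adj G x y ≡ true → adj G x z ≡ true → κ x y ≡ κ x z → y ≡ z)

Missing : (G : Graph) → EdgeColouring G k → Fin (n G) → Fin k → Set
Missing G κ v c = ∀ {w} → adj G v w ≡ true → κ v w ≢ c

module _ (G : Graph) {k} (κ : EdgeColouring G k) where

  present : Fin (n G) → Fin k → Bool
  present v c = does (exists? λ w → adj G v w ∧ (κ v w == c))

  present-intro : ∀ {v w} → adj G v w ≡ true → present v (κ v w) ≡ true
  present-intro {v} {w} vw = dec-true (exists? _) (w , ∧-intro vw (==-refl (κ v w)))

  present-elim : ∀ {v c} → present v c ≡ true → ∃ λ w → adj G v w ≡ true × κ v w ≡ c
  present-elim {v} {c} p with exists? (λ w → adj G v w ∧ (κ v w == c))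
  ... | yes (w , q) = w , proj₁ (∧-true q) , ==⇒≡ (proj₂ (∧-true q))

  absent⇒missing : ∀ {v c} → present v c ≡ false → Missing G κ v c
  absent⇒missing {v} absent {w} vw refl = contradiction (trans (sym (present-intro {v} {w} vw)) absent) λ ()

  missing⇒absent : ∀ {v c} → Missing G κ v c → present v c ≡ false
  missing⇒absent missing = ¬-not λ p → let w , vw , κvw≡c = present-elim p in missing vw κvw≡c

  count-present≤degree : ∀ v → count (present v) ≤ degree G v
  count-present≤degree v = count-injection (present v) (adj G v) (λ c p → proj₁ (present-elim p))
    (λ c p → proj₁ (proj₂ (present-elim p)))
    λ p q eq → trans (sym (proj₂ (proj₂ (present-elim p))))
                     (trans (cong (κ v) eq) (proj₂ (proj₂ (present-elim q))))

  count-present : IsProper G κ → ∀ v → count (present v) ≡ degree G v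
  count-present (_ , injective) v = ≤-antisym (count-present≤degree v)
    (count-injection (adj G v) (present v) (λ w _ → κ v w) (λ w vw → present-intro vw) injective)

  missing-colour : ∀ v → degree G v < k → ∃ (Missing G κ v)
  missing-colour v degree<k =
    let c , absent = count-pos⇒member (not ∘ present v) (+-cancelˡ-< (count (present v)) 0 _ 0<absent)
    in c , absent⇒missing (trans (sym (not-involutive _)) (cong not absent))
    where
    0<absent : count (present v) + 0 < count (present v) + count (not ∘ present v)
    0<absent = begin-strict
      count (present v) + 0 ≡⟨ +-identityʳ _ ⟩
      count (present v)     ≤⟨ count-present≤degree v ⟩
      degree G v            <⟨ degree<k ⟩
      k                     ≡⟨ count-complement (present v) ⟨
      count (present v) + count (not ∘ present v) ∎
      where open ≤-Reasoning

-- König's edge colouring theorem for bipartite graphs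

data Reachable {m} (R : Fin m → Fin m → Bool) (s : Fin m) : Fin m → Set where
  here  : Reachable R s s
  there : ∀ {x y} → Reachable R s x → R x y ≡ true → Reachable R s y

module _ {m} (R : Fin m → Fin m → Bool) where

  Closed : (Fin m → Bool) → Set
  Closed S = ∀ {x y} → S x ≡ true → R x y ≡ true → S y ≡ true

  grow : (Fin m → Bool) → Fin m → Bool
  grow S y = S y ∨ does (exists? λ x → S x ∧ R x y)

  ⊆-grow : ∀ S {x} → S x ≡ true → grow S x ≡ true
  ⊆-grow S Sx rewrite Sx = refl

  closed-or-grows : ∀ S → Closed S ⊎ count S < count (grow S)
  closed-or-grows S with exists? (λ y → not (S y) ∧ does (exists? λ x → S x ∧ R x y))
  ... | yes (y , p) = inj₂ (count-mono-strict S (grow S) (λ _ → ⊆-grow S) grow-y S-y)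
    where
    S-y : S y ≡ false
    S-y = ¬-not λ Sy → contradiction (trans (sym (proj₁ (∧-true p))) (cong not Sy)) λ ()
    grow-y : grow S y ≡ true
    grow-y rewrite S-y = proj₂ (∧-true p)
  ... | no ∄y = inj₁ closed
    where
    closed : Closed S
    closed {x} {y} Sx Rxy with S y in Sy
    ... | true  = refl
    ... | false = contradiction (y , ∧-intro (cong not Sy) (dec-true (exists? _) (x , ∧-intro Sx Rxy))) ∄y

  module _ (s : Fin m) where

    stage : ℕ → Fin m → Bool
    stage zero    = _== s
    stage (suc i) = grow (stage i)

    stage-seed : ∀ i → stage i s ≡ true
    stage-seed zero    = ==-refl s
    stage-seed (suc i) = ⊆-grow (stage i) (stage-seed i)

    stage-reachable : ∀ i {x} → stage i x ≡ true → Reachable R s x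
    stage-reachable zero    x==s = subst (Reachable R s) (sym (==⇒≡ x==s)) here
    stage-reachable (suc i) p with ∨-true p
    ... | inj₁ earlier = stage-reachable i earlier
    ... | inj₂ step    = let x , q = exists-witness (λ x → stage i x ∧ R x _) step in
                         there (stage-reachable i (proj₁ (∧-true q))) (proj₂ (∧-true q))

    closed-or-large : ∀ i → (∃ λ j → Closed (stage j)) ⊎ i < count (stage i)
    closed-or-large zero = inj₂ (member⇒count-pos (stage 0) {s} (stage-seed 0))
    closed-or-large (suc i) with closed-or-large i
    ... | inj₁ closed = inj₁ closed
    ... | inj₂ large with closed-or-grows (stage i)
    ...   | inj₁ closed = inj₁ (i , closed)
    ...   | inj₂ grows  = inj₂ (<-≤-trans (s≤s large) grows)

    -- The stages grow strictly until they are closed, and cannot exceed m elements.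
    closure : ∃ λ S → S s ≡ true × Closed S × (∀ {x} → S x ≡ true → Reachable R s x)
    closure with closed-or-large m
    ... | inj₁ (j , closed) = stage j , stage-seed j , closed , stage-reachable j
    ... | inj₂ large = contradiction (count-≤ (stage m)) (<⇒≱ large)

module _ {d} (α β : Fin d) where

  transpose-other : ∀ {c} → c ≢ α → c ≢ β → transpose α β c ≡ c
  transpose-other {c} c≢α c≢β rewrite dec-false (c ≟ᶠ α) c≢α | dec-false (c ≟ᶠ β) c≢β = refl

  transpose-β : transpose α β β ≡ α
  transpose-β with β ≟ᶠ α
  ... | yes β≡α = β≡α
  ... | no  _   rewrite dec-true (β ≟ᶠ β) refl = refl

  transpose-injective : ∀ {c c'} → transpose α β c ≡ transpose α β c' → c ≡ c'
  transpose-injective {c} {c'} eq =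
    trans (sym (transpose-inverse β α)) (trans (cong (transpose β α) eq) (transpose-inverse β α))

module KempeChain (G : Graph) (side : Fin (n G) → Bool) (bip : ∀ x y → adj G x y ≡ true → side x ≢ side y)
                  {d} {κ : EdgeColouring G d} (proper : IsProper G κ)
                  {u v : Fin (n G)} (u-v : side u ≢ side v) {α β : Fin d}
                  (α∉u : Missing G κ u α) (β∉v : Missing G κ v β) where

  private
    κ-sym = proj₁ proper
    κ-inj = proj₂ proper

  onSideOfV : Fin (n G) → Bool
  onSideOfV x = does (side x ≟ᵇ side v)

  leaving entering : Fin (n G) → Fin d
  leaving  x = if onSideOfV x then α else β
  entering x = if onSideOfV x then β else α

  onSideOfV-adj : ∀ {x y} → adj G x y ≡ true → onSideOfV x ≡ not (onSideOfV y)
  onSideOfV-adj {x} {y} xy with side x ≟ᵇ side v | side y ≟ᵇ side v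
  ... | yes x~v | yes y~v = contradiction (trans x~v (sym y~v)) (bip x y xy)
  ... | yes _   | no  _   = refl
  ... | no  _   | yes _   = refl
  ... | no  x≁v | no  y≁v = contradiction (trans (¬-not x≁v) (sym (¬-not y≁v))) (bip x y xy)

  leaving≡entering : ∀ {x y} → adj G x y ≡ true → leaving x ≡ entering y
  leaving≡entering {x} {y} xy rewrite onSideOfV-adj xy with onSideOfV y
  ... | true  = refl
  ... | false = refl

  step : Fin (n G) → Fin (n G) → Bool
  step x y = adj G x y ∧ (κ x y == leaving x)

  Chain : Fin (n G) → Set
  Chain = Reachable step v

  entered : ∀ {x} → Chain x → x ≡ v ⊎ ∃ λ y → adj G x y ≡ true × κ x y ≡ entering x × Chain y
  entered here = inj₁ refl
  entered (there {x} {y} x∈chain xy-step) = inj₂ (x , trans (Graph.sym G y x) xy , κyx≡entering , x∈chain)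
    where
    xy = proj₁ (∧-true xy-step)
    κyx≡entering : κ y x ≡ entering y
    κyx≡entering = trans (sym (κ-sym xy)) (trans (==⇒≡ (proj₂ (∧-true xy-step))) (leaving≡entering xy))

  leaving-or-entering : ∀ x {c} → c ≡ α ⊎ c ≡ β → c ≡ leaving x ⊎ c ≡ entering x
  leaving-or-entering x c∈αβ with onSideOfV x | c∈αβ
  ... | true  | inj₁ c≡α = inj₁ c≡α
  ... | true  | inj₂ c≡β = inj₂ c≡β
  ... | false | inj₁ c≡α = inj₂ c≡α
  ... | false | inj₂ c≡β = inj₁ c≡β

  -- An α- or β-edge at x that does not have the leaving colour is the edge by which the chain entered x.
  chain-closed : ∀ {x y} → Chain x → adj G x y ≡ true → κ x y ≡ α ⊎ κ x y ≡ β → Chain y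
  chain-closed {x} {y} x∈chain xy κxy∈αβ with leaving-or-entering x κxy∈αβ
  ... | inj₁ κxy≡leaving = there x∈chain (∧-intro xy (≡⇒== κxy≡leaving))
  ... | inj₂ κxy≡entering with entered x∈chain
  ...   | inj₁ refl = contradiction κxy≡entering (β∉v' xy)
    where
    β∉v' : ∀ {w} → adj G v w ≡ true → κ v w ≢ entering v
    β∉v' vw rewrite dec-true (side v ≟ᵇ side v) refl = β∉v vw
  ...   | inj₂ (y' , xy' , κxy'≡entering , y'∈chain) =
    subst Chain (κ-inj xy' xy (trans κxy'≡entering (sym κxy≡entering))) y'∈chain

  -- The chain enters the vertices on u's side along α-edges, and α is missing at u.
  u∉chain : ¬ Chain u
  u∉chain u∈chain with entered u∈chain
  ... | inj₁ refl = u-v refl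
  ... | inj₂ (y , uy , κuy≡entering , _) = α∉u uy (trans κuy≡entering entering-u)
    where
    entering-u : entering u ≡ α
    entering-u rewrite dec-false (side u ≟ᵇ side v) u-v = refl

  private
    chain-closure = closure step v

  inChain : Fin (n G) → Bool
  inChain = proj₁ chain-closure

  inChain-sound : ∀ {x} → inChain x ≡ true → Chain x
  inChain-sound = proj₂ (proj₂ (proj₂ chain-closure))

  inChain-complete : ∀ {x} → Chain x → inChain x ≡ true
  inChain-complete here              = proj₁ (proj₂ chain-closure)
  inChain-complete (there x∈chain s) = proj₁ (proj₂ (proj₂ chain-closure)) (inChain-complete x∈chain) s

  swapped : EdgeColouring G d
  swapped x y = if inChain x then transpose α β (κ x y) else κ x y

  leaving-chain : ∀ {x y} → inChain x ≡ true → inChain y ≡ false → adj G x y ≡ true →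
    transpose α β (κ x y) ≡ κ x y
  leaving-chain {x} {y} x∈ y∉ xy = transpose-other α β (y∈ ∘ inj₁) (y∈ ∘ inj₂)
    where
    y∈ : κ x y ≡ α ⊎ κ x y ≡ β → ⊥
    y∈ κxy∈αβ =
      contradiction (trans (sym (inChain-complete (chain-closed (inChain-sound x∈) xy κxy∈αβ))) y∉) λ ()

  swapped-proper : IsProper G swapped
  swapped-proper = swapped-sym , swapped-inj
    where
    swapped-sym : ∀ {x y} → adj G x y ≡ true → swapped x y ≡ swapped y x
    swapped-sym {x} {y} xy with inChain x in x∈ | inChain y in y∈
    ... | true  | true  = cong (transpose α β) (κ-sym xy)
    ... | false | false = κ-sym xy
    ... | true  | false = trans (leaving-chain x∈ y∈ xy) (κ-sym xy)
    ... | false | true  = trans (κ-sym xy) (sym (leaving-chain y∈ x∈ (trans (Graph.sym G y x) xy)))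
    swapped-inj : ∀ {x y z} → adj G x y ≡ true → adj G x z ≡ true → swapped x y ≡ swapped x z → y ≡ z
    swapped-inj {x} xy xz eq with inChain x
    ... | true  = κ-inj xy xz (transpose-injective α β eq)
    ... | false = κ-inj xy xz eq

  α∉u-swapped : Missing G swapped u α
  α∉u-swapped uw rewrite ¬-not (u∉chain ∘ inChain-sound) = α∉u uw

  α∉v-swapped : Missing G swapped v α
  α∉v-swapped vw eq rewrite inChain-complete here =
    β∉v vw (transpose-injective α β (trans eq (sym (transpose-β α β))))

isPair : (u v x y : Fin m) → Bool
isPair u v x y = (x == u ∧ y == v) ∨ (x == v ∧ y == u)

isPair-sym : (u v x y : Fin m) → isPair u v x y ≡ isPair u v y x
isPair-sym u v x y =
  trans (∨-comm (x == u ∧ y == v) _) (cong₂ _∨_ (∧-comm (x == v) _) (∧-comm (x == u) _))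

isPair-refl : (u v : Fin m) → isPair u v u v ≡ true
isPair-refl u v rewrite ==-refl u | ==-refl v = refl

isPair-elim : (u v x y : Fin m) → isPair u v x y ≡ true → (x ≡ u × y ≡ v) ⊎ (x ≡ v × y ≡ u)
isPair-elim u v x y p with ∨-true p
... | inj₁ q = inj₁ (==⇒≡ (proj₁ (∧-true q)) , ==⇒≡ (proj₂ (∧-true q)))
... | inj₂ q = inj₂ (==⇒≡ (proj₁ (∧-true q)) , ==⇒≡ (proj₂ (∧-true q)))

isPair-partner : {u v : Fin m} (x y z : Fin m) → u ≢ v →
  isPair u v x y ≡ true → isPair u v x z ≡ true → y ≡ z
isPair-partner {u = u} {v} x y z u≢v p q with isPair-elim u v x y p | isPair-elim u v x z q
... | inj₁ (_ , y≡v) | inj₁ (_ , z≡v) = trans y≡v (sym z≡v)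
... | inj₂ (_ , y≡u) | inj₂ (_ , z≡u) = trans y≡u (sym z≡u)
... | inj₁ (x≡u , _) | inj₂ (x≡v , _) = contradiction (trans (sym x≡u) x≡v) u≢v
... | inj₂ (x≡v , _) | inj₁ (x≡u , _) = contradiction (trans (sym x≡u) x≡v) u≢v

removeEdge : (G : Graph) → Fin (n G) → Fin (n G) → Graph
removeEdge G u v = record
  { n     = n G
  ; adj   = λ x y → adj G x y ∧ not (isPair u v x y)
  ; sym   = λ x y → cong₂ (λ a b → a ∧ not b) (Graph.sym G x y) (isPair-sym u v x y)
  ; irrfl = λ x → cong (_∧ _) (irrfl G x)
  }

edges : (G : Graph) → Fin (n G * n G) → Bool
edges G p = uncurry (adj G) (remQuot (n G) p)

edgeCount : Graph → ℕ
edgeCount G = count (edges G)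

removeEdge-edgeCount : (G : Graph) (u v : Fin (n G)) → adj G u v ≡ true →
  edgeCount (removeEdge G u v) < edgeCount G
removeEdge-edgeCount G u v uv = count-mono-strict (edges (removeEdge G u v)) (edges G)
  (λ _ e → proj₁ (∧-true e)) uv-edge uv-removed
  where
  uv-edge : edges G (combine u v) ≡ true
  uv-edge = subst (λ p → uncurry (adj G) p ≡ true) (sym (remQuot-combine u v)) uv
  uv-removed : edges (removeEdge G u v) (combine u v) ≡ false
  uv-removed = trans (cong (uncurry (adj (removeEdge G u v))) (remQuot-combine u v))
                     (trans (cong (λ b → adj G u v ∧ not b) (isPair-refl u v)) (∧-zeroʳ (adj G u v)))

removeEdge-degree≤ : (G : Graph) (u v x : Fin (n G)) → degree (removeEdge G u v) x ≤ degree G x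
removeEdge-degree≤ G u v x = count-mono (adj (removeEdge G u v) x) (adj G x) λ _ e → proj₁ (∧-true e)

removeEdge-degree< : (G : Graph) (u v : Fin (n G)) {x y : Fin (n G)} → adj G x y ≡ true → isPair u v x y ≡ true →
  degree (removeEdge G u v) x < degree G x
removeEdge-degree< G u v {x} {y} xy p =
  count-mono-strict (adj (removeEdge G u v) x) (adj G x) (λ _ e → proj₁ (∧-true e)) xy
    (trans (cong (λ b → adj G x y ∧ not b) p) (∧-zeroʳ (adj G x y)))

removeEdge-bipartite : (G : Graph) {u v : Fin (n G)} → Bipartite G → Bipartite (removeEdge G u v)
removeEdge-bipartite G (side , bip) = side , λ x y e → bip x y (proj₁ (∧-true e))

ProperlyColourable : Graph → ℕ → Set
ProperlyColourable G k = ∃ λ (κ : EdgeColouring G k) → IsProper G κ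

module _ (G : Graph) {u v : Fin (n G)} (uv : adj G u v ≡ true) where

  private
    G-uv = removeEdge G u v

  u≢v : u ≢ v
  u≢v refl = contradiction (trans (sym uv) (irrfl G u)) λ ()

  remaining : ∀ {x y} → adj G x y ≡ true → isPair u v x y ≡ false → adj G-uv x y ≡ true
  remaining xy p rewrite xy | p = refl

  module _ {k} {κ : EdgeColouring G-uv k} (proper : IsProper G-uv κ)
           {c : Fin k} (c∉u : Missing G-uv κ u c) (c∉v : Missing G-uv κ v c) where

    withEdge : EdgeColouring G k
    withEdge x y = if isPair u v x y then c else κ x y

    c∉endpoint : ∀ x y → isPair u v x y ≡ true → Missing G-uv κ x c
    c∉endpoint x y p with isPair-elim u v x y p
    ... | inj₁ (refl , _) = c∉u
    ... | inj₂ (refl , _) = c∉v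

    withEdge-proper : IsProper G withEdge
    withEdge-proper = withEdge-sym , withEdge-inj
      where
      withEdge-sym : ∀ {x y} → adj G x y ≡ true → withEdge x y ≡ withEdge y x
      withEdge-sym {x} {y} xy rewrite isPair-sym u v y x with isPair u v x y in p
      ... | true  = refl
      ... | false = proj₁ proper (remaining xy p)
      withEdge-inj : ∀ {x y z} → adj G x y ≡ true → adj G x z ≡ true → withEdge x y ≡ withEdge x z → y ≡ z
      withEdge-inj {x} {y} {z} xy xz eq with isPair u v x y in p | isPair u v x z in q
      ... | true  | true  = isPair-partner x y z u≢v p q
      ... | true  | false = contradiction (sym eq) (c∉endpoint x y p (remaining xz q))
      ... | false | true  = contradiction eq (c∉endpoint x z q (remaining xy p))
      ... | false | false = proj₂ proper (remaining xy p) (remaining xz q) eq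

  -- Some α is missing at u and some β at v; a Kempe swap makes α missing at v too, and uv gets α.
  restoreEdge : Bipartite G → ∀ {d} → (∀ x → degree G x ≤ d) →
    ProperlyColourable G-uv d → ProperlyColourable G d
  restoreEdge (side , bip) degree≤d (κ , proper) =
    withEdge swapped-proper α∉u-swapped α∉v-swapped , withEdge-proper swapped-proper α∉u-swapped α∉v-swapped
    where
    vu = trans (Graph.sym G v u) uv
    u-free = <-≤-trans (removeEdge-degree< G u v uv (isPair-refl u v)) (degree≤d u)
    v-free = <-≤-trans (removeEdge-degree< G u v vu (trans (isPair-sym u v v u) (isPair-refl u v))) (degree≤d v)
    open KempeChain G-uv side (proj₂ (removeEdge-bipartite G (side , bip))) proper (bip u v uv)
                    (proj₂ (missing-colour G-uv κ u u-free)) (proj₂ (missing-colour G-uv κ v v-free))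

module _ (d : ℕ) .{{_ : NonZero d}} where

  konig-bounded : ∀ e (G : Graph) → edgeCount G ≤ e → Bipartite G → (∀ v → degree G v ≤ d) →
    ProperlyColourable G d
  konig-bounded e G size bip degree≤d with exists? (edges G)
  ... | no ∄edge = (λ _ _ → fromℕ< (>-nonZero⁻¹ d)) , ⊥-elim ∘ no-edge , λ xy _ _ → ⊥-elim (no-edge xy)
    where
    no-edge : ∀ {x y} → adj G x y ≡ true → ⊥
    no-edge {x} {y} xy =
      ∄edge (combine x y , subst (λ p → uncurry (adj G) p ≡ true) (sym (remQuot-combine x y)) xy)
  ... | yes (p , uv) = restoreEdge G {u} {v} uv bip degree≤d (smaller e size)
    where
    u = proj₁ (remQuot {n G} (n G) p)
    v = proj₂ (remQuot {n G} (n G) p)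
    smaller : ∀ e → edgeCount G ≤ e → ProperlyColourable (removeEdge G u v) d
    smaller zero    size = contradiction size (<⇒≱ (member⇒count-pos (edges G) {p} uv))
    smaller (suc e) size =
      konig-bounded e (removeEdge G u v) (s≤s⁻¹ (<-≤-trans (removeEdge-edgeCount G u v uv) size))
        (removeEdge-bipartite G bip) λ x → ≤-trans (removeEdge-degree≤ G u v x) (degree≤d x)

-- Only the properties of the colouring are ever used, and unfolding it would swamp the type checker.
opaque
  konig : (G : Graph) → Bipartite G → (d : ℕ) .{{_ : NonZero d}} → (∀ v → degree G v ≤ d) →
    ProperlyColourable G d
  konig G bip d degree≤d = konig-bounded d (edgeCount G) G ≤-refl bip degree≤d

-- Balanced 2-labellings

divMod-injective : ∀ {x y} d .{{_ : NonZero d}} → x / d ≡ y / d → x % d ≡ y % d → x ≡ y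
divMod-injective {x} {y} d x/d≡y/d x%d≡y%d = begin
  x                 ≡⟨ m≡m%n+[m/n]*n x d ⟩
  x % d + x / d * d ≡⟨ cong₂ (λ r q → r + q * d) x%d≡y%d x/d≡y/d ⟩
  y % d + y / d * d ≡⟨ m≡m%n+[m/n]*n y d ⟨
  y                 ∎
  where open ≡-Reasoning

n≤⌈n/2⌉*2 : ∀ n → n ≤ ⌈ n /2⌉ * 2
n≤⌈n/2⌉*2 n = begin
  n                   ≡⟨ ⌊n/2⌋+⌈n/2⌉≡n n ⟨
  ⌊ n /2⌋ + ⌈ n /2⌉   ≤⟨ +-monoˡ-≤ ⌈ n /2⌉ (⌊n/2⌋≤⌈n/2⌉ n) ⟩
  ⌈ n /2⌉ + ⌈ n /2⌉   ≡⟨ cong (⌈ n /2⌉ +_) (+-identityʳ ⌈ n /2⌉) ⟨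
  2 * ⌈ n /2⌉         ≡⟨ *-comm 2 ⌈ n /2⌉ ⟩
  ⌈ n /2⌉ * 2         ∎
  where open ≤-Reasoning

module Ranks (G : Graph) where

  neighbourBelow : Fin (n G) → Fin (n G) → Fin (n G) → Bool
  neighbourBelow v w x = adj G v x ∧ does (x <? w)

  rank : Fin (n G) → Fin (n G) → ℕ
  rank v w = count (neighbourBelow v w)

  private
    below-self : ∀ v w → neighbourBelow v w w ≡ false
    below-self v w rewrite dec-false (w <? w) (<ᶠ-irrefl refl) = ∧-zeroʳ (adj G v w)

  rank-<-mono : ∀ {v w w'} → adj G v w ≡ true → w <ᶠ w' → rank v w < rank v w'
  rank-<-mono {v} {w} {w'} vw w<w' =
    count-mono-strict (neighbourBelow v w) (neighbourBelow v w') below-w⇒below-w'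
      (∧-intro vw (dec-true (w <? w') w<w')) (below-self v w)
    where
    below-w⇒below-w' : ∀ x → neighbourBelow v w x ≡ true → neighbourBelow v w' x ≡ true
    below-w⇒below-w' x p = let vx , x<w = ∧-true p in
      ∧-intro vx (dec-true (x <? w') (<ᶠ-trans (does⇒ (x <? w) x<w) w<w'))

  rank-injective : ∀ {v w w'} → adj G v w ≡ true → adj G v w' ≡ true → rank v w ≡ rank v w' → w ≡ w'
  rank-injective {v} {w} {w'} vw vw' eq with <-cmp w w'
  ... | tri< w<w' _ _ = contradiction eq (<⇒≢ (rank-<-mono vw w<w'))
  ... | tri≈ _ w≡w' _ = w≡w'
  ... | tri> _ _ w'<w = contradiction (sym eq) (<⇒≢ (rank-<-mono vw' w'<w))

  rank<degree : ∀ {v w} → adj G v w ≡ true → rank v w < degree G v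
  rank<degree {v} {w} vw =
    count-mono-strict (neighbourBelow v w) (adj G v) (λ _ p → proj₁ (∧-true p)) vw (below-self v w)

  rank<size : ∀ v w → rank v w < n G
  rank<size v w = <-≤-trans
    (count-mono-strict (neighbourBelow v w) (λ _ → true) (λ _ _ → refl) refl (below-self v w))
    (≤-reflexive (count-true {n G}))

  -- Vertex v is split into copies, the copy numbered i holding the neighbours of rank 2i and 2i+1.
  copyIndex : Fin (n G) → Fin (n G) → Fin (n G)
  copyIndex v w = fromℕ< (≤-<-trans (m/n≤m (rank v w) 2) (rank<size v w))

  toℕ-copyIndex : ∀ v w → toℕ (copyIndex v w) ≡ rank v w / 2
  toℕ-copyIndex v w = toℕ-fromℕ< _

  copyOf : Fin (n G) → Fin (n G) → Fin (n G * n G)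
  copyOf v w = combine v (copyIndex v w)

  owner : Fin (n G * n G) → Fin (n G)
  owner p = proj₁ (remQuot {n G} (n G) p)

  owner-copyOf : ∀ v w → owner (copyOf v w) ≡ v
  owner-copyOf v w = cong proj₁ (remQuot-combine v (copyIndex v w))

  splitAdj : Fin (n G * n G) → Fin (n G * n G) → Bool
  splitAdj p q = adj G (owner p) (owner q) ∧ (copyOf (owner p) (owner q) == p ∧ copyOf (owner q) (owner p) == q)

  splitAdj-sym : ∀ p q → splitAdj p q ≡ splitAdj q p
  splitAdj-sym p q =
    cong₂ _∧_ (Graph.sym G (owner p) (owner q)) (∧-comm (copyOf (owner p) (owner q) == p) _)

  splitAdj-elim : ∀ {p q} → splitAdj p q ≡ true →
    adj G (owner p) (owner q) ≡ true × copyOf (owner p) (owner q) ≡ p × copyOf (owner q) (owner p) ≡ q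
  splitAdj-elim e = let ab , ends = ∧-true e in
    ab , ==⇒≡ (proj₁ (∧-true ends)) , ==⇒≡ (proj₂ (∧-true ends))

  splitAdj-copyOf : ∀ {v w} → adj G v w ≡ true → splitAdj (copyOf v w) (copyOf w v) ≡ true
  splitAdj-copyOf {v} {w} vw
    rewrite owner-copyOf v w | owner-copyOf w v | vw | ==-refl (copyOf v w) | ==-refl (copyOf w v) = refl

  -- The neighbours of a copy have ranks of equal quotient by 2, so their parities tell them apart.
  split-degree≤2 : ∀ p → count (splitAdj p) ≤ 2
  split-degree≤2 p = ≤-trans
    (count-injection (splitAdj p) (λ _ → true) (λ q _ → parity (owner q)) (λ _ _ → refl) parity-inj)
    (≤-reflexive (count-true {2}))
    where
    a = owner p
    parity : Fin (n G) → Fin 2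
    parity b = fromℕ< (m%n<n (rank a b) 2)
    parity-inj : ∀ {q q'} → splitAdj p q ≡ true → splitAdj p q' ≡ true →
      parity (owner q) ≡ parity (owner q') → q ≡ q'
    parity-inj {q} {q'} pq pq' eq = begin
      q                   ≡⟨ proj₂ (proj₂ (splitAdj-elim pq)) ⟨
      copyOf (owner q) a  ≡⟨ cong (λ b → copyOf b a) same-owner ⟩
      copyOf (owner q') a ≡⟨ proj₂ (proj₂ (splitAdj-elim pq')) ⟩
      q'                  ∎
      where
      open ≡-Reasoning
      same-index : copyIndex a (owner q) ≡ copyIndex a (owner q')
      same-index = combine-injectiveʳ a _ a _
        (trans (proj₁ (proj₂ (splitAdj-elim pq))) (sym (proj₁ (proj₂ (splitAdj-elim pq')))))
      same-half : rank a (owner q) / 2 ≡ rank a (owner q') / 2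
      same-half = trans (sym (toℕ-copyIndex a (owner q))) (trans (cong toℕ same-index) (toℕ-copyIndex a (owner q')))
      same-owner : owner q ≡ owner q'
      same-owner = rank-injective (proj₁ (splitAdj-elim pq)) (proj₁ (splitAdj-elim pq'))
        (divMod-injective 2 same-half (fromℕ<-injective _ _ _ _ eq))

IsBalanced : (G : Graph) → EdgeColouring G 2 → Set
IsBalanced G label = (∀ {x y} → adj G x y ≡ true → label x y ≡ label y x) ×
                     (∀ v i → count (λ w → adj G v w ∧ label v w == i) ≤ ⌈ degree G v /2⌉)

-- Properly 2-colour the graph in which every vertex is split into copies of degree at most 2;
-- each copy then sees each label at most once.
balancedLabelling : (G : Graph) → Bipartite G → ∃ (IsBalanced G)
balancedLabelling G (side , bip) = label , label-sym , balanced
  where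
  open Ranks G
  splitGraph = bipartiteGraph splitAdj splitAdj-sym (λ p → side (owner p))
                 λ p q pq → bip (owner p) (owner q) (proj₁ (splitAdj-elim pq))
  colouring = konig (proj₁ splitGraph) (proj₂ splitGraph) 2 split-degree≤2
  s = proj₁ colouring
  s-proper = proj₂ colouring

  label : EdgeColouring G 2
  label v w = s (copyOf v w) (copyOf w v)

  label-sym : ∀ {x y} → adj G x y ≡ true → label x y ≡ label y x
  label-sym xy = proj₁ s-proper (splitAdj-copyOf xy)

  balanced : ∀ v i → count (λ w → adj G v w ∧ label v w == i) ≤ ⌈ degree G v /2⌉
  balanced v i = ≤-trans (count-injection labelled (λ _ → true) index (λ _ _ → refl) index-inj)
                         (≤-reflexive count-true)
    where
    labelled : Fin (n G) → Bool
    labelled w = adj G v w ∧ label v w == i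
    index : ∀ w → labelled w ≡ true → Fin ⌈ degree G v /2⌉
    index w p = fromℕ< (m<n*o⇒m/o<n (<-≤-trans (rank<degree (proj₁ (∧-true p))) (n≤⌈n/2⌉*2 (degree G v))))
    index-inj : ∀ {w w'} p p' → index w p ≡ index w' p' → w ≡ w'
    index-inj {w} {w'} p p' eq =
      combine-injectiveˡ w (copyIndex w v) w' (copyIndex w' v) (proj₂ s-proper vw vw' same-label)
      where
      same-copy : copyOf v w' ≡ copyOf v w
      same-copy = cong (combine v) (toℕ-injective (trans (toℕ-copyIndex v w')
                    (trans (sym (fromℕ<-injective _ _ _ _ eq)) (sym (toℕ-copyIndex v w)))))
      vw : splitAdj (copyOf v w) (copyOf w v) ≡ true
      vw = splitAdj-copyOf (proj₁ (∧-true p))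
      vw' : splitAdj (copyOf v w) (copyOf w' v) ≡ true
      vw' = subst (λ c → splitAdj c (copyOf w' v) ≡ true) same-copy (splitAdj-copyOf (proj₁ (∧-true p')))
      same-label : s (copyOf v w) (copyOf w v) ≡ s (copyOf v w) (copyOf w' v)
      same-label = trans (==⇒≡ (proj₂ (∧-true p)))
                   (trans (sym (==⇒≡ (proj₂ (∧-true p')))) (cong (λ c → s c (copyOf w' v)) same-copy))

-- Cyclic intervals

IsInterval-⇔ : {A B : ℕ → Set} → (∀ x → A x ⇔ B x) → IsInterval A → IsInterval B
IsInterval-⇔ A⇔B (a , b , A⇔[a,b]) =
  a , b , λ x → mk⇔ (Equivalence.to (A⇔[a,b] x) ∘′ Equivalence.from (A⇔B x))
                    (Equivalence.to (A⇔B x) ∘′ Equivalence.from (A⇔[a,b] x))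

interval-empty : {A : ℕ → Set} → (∀ x → ¬ A x) → IsInterval A
interval-empty ∄A = 1 , 0 , λ x → mk⇔ (⊥-elim ∘ ∄A x) λ { (s≤s _ , ()) }

interval-two : {A : ℕ → Set} {c c' : ℕ} → c ≤ c' → c' ≤ suc c →
  (∀ x → A x ⇔ (x ≡ c ⊎ x ≡ c')) → IsInterval A
interval-two {A} {c} {c'} c≤c' c'≤1+c A⇔ = c , c' , λ x → mk⇔ (to x) (from x)
  where
  to : ∀ x → A x → c ≤ x × x ≤ c'
  to x Ax with Equivalence.to (A⇔ x) Ax
  ... | inj₁ refl = ≤-refl , c≤c'
  ... | inj₂ refl = c≤c' , ≤-refl
  from : ∀ x → c ≤ x × x ≤ c' → A x
  from x (c≤x , x≤c') = Equivalence.from (A⇔ x) (x≡c⊎c' (m≤n⇒m<n∨m≡n c≤x))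
    where
    x≡c⊎c' : c < x ⊎ c ≡ x → x ≡ c ⊎ x ≡ c'
    x≡c⊎c' (inj₁ c<x) = inj₂ (≤-antisym x≤c' (≤-trans c'≤1+c c<x))
    x≡c⊎c' (inj₂ c≡x) = inj₁ (sym c≡x)

-- Colours are numbered 1, …, t, the colour y : Fin t having number suc (toℕ y).
oneBased : (Fin t → Bool) → ℕ → Set
oneBased P x = ∃ λ y → P y ≡ true × suc (toℕ y) ≡ x

oneBased-≤1 : (P : Fin t → Bool) → count P ≤ 1 → IsInterval (oneBased P)
oneBased-≤1 P count≤1 with exists? P
... | no ∄P = interval-empty λ { x (y , Py , _) → ∄P (y , Py) }
... | yes (y₀ , Py₀) = interval-two ≤-refl (n≤1+n _) λ x → mk⇔
  (λ { (y , Py , refl) → inj₁ (cong (suc ∘ toℕ) (count-≤1-unique P count≤1 Py Py₀)) })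
  (λ { (inj₁ refl) → y₀ , Py₀ , refl ; (inj₂ refl) → y₀ , Py₀ , refl })

oneBased-consecutive : (P : Fin t → Bool) → count P ≤ 2 →
  {y y' : Fin t} → P y ≡ true → P y' ≡ true → toℕ y' ≡ suc (toℕ y) → IsInterval (oneBased P)
oneBased-consecutive P count≤2 {y} {y'} Py Py' y'≡1+y =
  interval-two (s≤s (≤-trans (n≤1+n _) (≤-reflexive (sym y'≡1+y)))) (s≤s (≤-reflexive y'≡1+y)) λ x → mk⇔
    (λ { (z , Pz , refl) →
         map-⊎ (cong (suc ∘ toℕ)) (cong (suc ∘ toℕ)) (count-≤2-cases P count≤2 Py Py' y≢y' Pz) })
    (λ { (inj₁ refl) → y , Py , refl ; (inj₂ refl) → y' , Py' , refl })
  where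
  y≢y' : y ≢ y'
  y≢y' refl = <-irrefl y'≡1+y (n<1+n (toℕ y))

module _ (G : Graph) {t} (κ : EdgeColouring G t) where

  colourNumber : Fin (n G) → Fin (n G) → ℕ
  colourNumber x y = suc (toℕ (κ x y))

  Uncoloured : Fin (n G) → ℕ → Set
  Uncoloured v x = (1 ≤ x × x ≤ t) × ¬ ColoursAt G colourNumber v x

  coloursAt⇔ : ∀ v x → ColoursAt G colourNumber v x ⇔ oneBased (present G κ v) x
  coloursAt⇔ v x = mk⇔ (λ { (w , vw , refl) → κ v w , present-intro G κ vw , refl })
    λ { (y , p , refl) → let w , vw , κvw≡y = present-elim G κ p in w , vw , cong (suc ∘ toℕ) κvw≡y }

  uncoloured⇔ : ∀ v x → Uncoloured v x ⇔ oneBased (not ∘ present G κ v) x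
  uncoloured⇔ v x = mk⇔ to from
    where
    to : Uncoloured v x → oneBased (not ∘ present G κ v) x
    to ((s≤s {n = k} _ , k<t) , ∉colours) = fromℕ< k<t , cong not absent , cong suc (toℕ-fromℕ< k<t)
      where
      absent : present G κ v (fromℕ< k<t) ≡ false
      absent = ¬-not λ p → ∉colours (Equivalence.from (coloursAt⇔ v x) (_ , p , cong suc (toℕ-fromℕ< k<t)))
    from : oneBased (not ∘ present G κ v) x → Uncoloured v x
    from (y , absent , refl) = (s≤s z≤n , toℕ<n y) , λ c →
      let y' , p , eq = Equivalence.to (coloursAt⇔ v x) c
          y'≡y = toℕ-injective (cong pred eq)
      in contradiction (trans (sym (cong not (subst (λ z → present G κ v z ≡ true) y'≡y p))) absent) λ ()

  module _ (proper : IsProper G κ) (v : Fin (n G)) where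

    degree+absent : degree G v + count (not ∘ present G κ v) ≡ t
    degree+absent = trans (cong (_+ count (not ∘ present G κ v)) (sym (count-present G κ proper v)))
                          (count-complement (present G κ v))

    cyclic-if-present-≤1 : count (present G κ v) ≤ 1 → IsCyclicInterval t (ColoursAt G colourNumber v)
    cyclic-if-present-≤1 count≤1 =
      inj₁ (IsInterval-⇔ (λ x → ⇔-sym (coloursAt⇔ v x)) (oneBased-≤1 _ count≤1))

    cyclic-if-absent-≤1 : count (not ∘ present G κ v) ≤ 1 → IsCyclicInterval t (ColoursAt G colourNumber v)
    cyclic-if-absent-≤1 count≤1 =
      inj₂ (IsInterval-⇔ (λ x → ⇔-sym (uncoloured⇔ v x)) (oneBased-≤1 _ count≤1))

    cyclic-if-absent-consecutive : count (not ∘ present G κ v) ≤ 2 → {y y' : Fin t} →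
      Missing G κ v y → Missing G κ v y' → toℕ y' ≡ suc (toℕ y) →
      IsCyclicInterval t (ColoursAt G colourNumber v)
    cyclic-if-absent-consecutive count≤2 y∉v y'∉v y'≡1+y =
      inj₂ (IsInterval-⇔ (λ x → ⇔-sym (uncoloured⇔ v x))
        (oneBased-consecutive _ count≤2 (cong not (missing⇒absent G κ y∉v)) (cong not (missing⇒absent G κ y'∉v))
                              y'≡1+y))

  cyclicIntervalColouring : IsProper G κ → (∀ v → IsCyclicInterval t (ColoursAt G colourNumber v)) →
    IsCyclicIntervalColouring G t colourNumber
  cyclicIntervalColouring (κ-sym , κ-inj) cyclic =
    (λ x y xy → cong (suc ∘ toℕ) (κ-sym xy)) ,
    (λ x y xy → s≤s z≤n , toℕ<n (κ x y)) ,
    (λ x y z xy xz y≢z eq → y≢z (κ-inj xy xz (toℕ-injective (cong pred eq)))) ,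
    cyclic

-- Cyclic interval colourings for degrees 1, 2r − 2, 2r − 1 and 2r

AdmissibleDegree : ℕ → ℕ → Set
AdmissibleDegree r d = d ≡ 1 ⊎ d + 2 ≡ r * 2 ⊎ d + 1 ≡ r * 2 ⊎ d ≡ r * 2

admissible⇒≤ : ∀ r .{{_ : NonZero r}} {d} → AdmissibleDegree r d → d ≤ r * 2
admissible⇒≤ (suc r) (inj₁ refl)                = s≤s z≤n
admissible⇒≤ r {d} (inj₂ (inj₁ d+2≡))        = ≤-trans (m≤m+n d 2) (≤-reflexive d+2≡)
admissible⇒≤ r {d} (inj₂ (inj₂ (inj₁ d+1≡))) = ≤-trans (m≤m+n d 1) (≤-reflexive d+1≡)
admissible⇒≤ r     (inj₂ (inj₂ (inj₂ d≡)))   = ≤-reflexive d≡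

⌈r*2/2⌉≡r : ∀ r → ⌈ r * 2 /2⌉ ≡ r
⌈r*2/2⌉≡r r = sym (trans (n≡⌈n+n/2⌉ r) (cong ⌈_/2⌉ r+r≡r*2))
  where
  r+r≡r*2 : r + r ≡ r * 2
  r+r≡r*2 = trans (cong (r +_) (sym (+-identityʳ r))) (*-comm 2 r)

⌈d+2/2⌉≡1+⌈d/2⌉ : ∀ d → ⌈ d + 2 /2⌉ ≡ suc ⌈ d /2⌉
⌈d+2/2⌉≡1+⌈d/2⌉ d = cong ⌈_/2⌉ (+-comm d 2)

flipBy : Fin 2 → Bool → Bool
flipBy zero       b = b
flipBy (suc zero) b = not b

flipBy-injective : ∀ i {b b'} → flipBy i b ≡ flipBy i b' → b ≡ b'
flipBy-injective zero       eq = eq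
flipBy-injective (suc zero) eq = not-injective eq

flipBy-≢ : ∀ {i j} → i ≢ j → ∀ b → flipBy i b ≢ flipBy j b
flipBy-≢ {zero}     {zero}     i≢j   = contradiction refl i≢j
flipBy-≢ {zero}     {suc zero} _   b = not-¬ refl
flipBy-≢ {suc zero} {zero}     _   b = not-¬ refl ∘ sym
flipBy-≢ {suc zero} {suc zero} i≢j   = contradiction refl i≢j

Fin2-≢⇒≡ : {i j k : Fin 2} → j ≢ i → k ≢ i → j ≡ k
Fin2-≢⇒≡ {zero}     {zero}                 j≢i _   = contradiction refl j≢i
Fin2-≢⇒≡ {zero}     {suc zero} {zero}      _   k≢i = contradiction refl k≢i
Fin2-≢⇒≡ {zero}     {suc zero} {suc zero}  _   _   = refl
Fin2-≢⇒≡ {suc zero} {zero}     {zero}      _   _   = refl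
Fin2-≢⇒≡ {suc zero} {zero}     {suc zero}  _   k≢i = contradiction refl k≢i
Fin2-≢⇒≡ {suc zero} {suc zero}             j≢i _   = contradiction refl j≢i

module Construction (G : Graph) (side : Fin (n G) → Bool)
                    (bip : ∀ x y → adj G x y ≡ true → side x ≢ side y)
                    {label : EdgeColouring G 2} (balanced : IsBalanced G label)
                    (r : ℕ) .{{_ : NonZero r}} (admissible : ∀ v → AdmissibleDegree r (degree G v)) where

  private
    label-sym = proj₁ balanced

  short : Fin (n G) → Bool
  short v = does (degree G v + 2 ≟ r * 2)

  -- H has copies (v, 0) and (v, 1) of every vertex: an edge vw of label i joins (v, i) to (w, i),
  -- and the two copies of a short vertex are joined to each other.
  layeredAdj : Fin (n G) × Fin 2 → Fin (n G) × Fin 2 → Bool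
  layeredAdj (a , i) (b , j) = i == j ∧ adj G a b ∧ label a b == i ∨ not (i == j) ∧ a == b ∧ short a

  layeredAdj-sym : ∀ x y → layeredAdj x y ≡ layeredAdj y x
  layeredAdj-sym (a , i) (b , j) = cong₂ _∨_
    (trans (cong (_∧ _) (==-sym i j)) (∧-cong-if λ j==i → edge-sym (==⇒≡ j==i)))
    (trans (cong (λ e → not e ∧ _) (==-sym i j)) (cong (not (j == i) ∧_)
      (trans (cong (_∧ short a) (==-sym a b)) (∧-cong-if λ b==a → cong short (sym (==⇒≡ b==a))))))
    where
    edge-sym : j ≡ i → (adj G a b ∧ label a b == i) ≡ (adj G b a ∧ label b a == j)
    edge-sym refl =
      trans (∧-cong-if λ ab → cong (_== j) (label-sym ab)) (cong (_∧ (label b a == j)) (Graph.sym G a b))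

  layeredSide : Fin (n G) × Fin 2 → Bool
  layeredSide (a , i) = flipBy i (side a)

  layeredAdj-bip : ∀ x y → layeredAdj x y ≡ true → layeredSide x ≢ layeredSide y
  layeredAdj-bip (a , i) (b , j) e with ∨-true {i == j ∧ adj G a b ∧ label a b == i} e
  ... | inj₁ same-layer =
    let i==j , ab = ∧-true {i == j} same-layer
        i≡j = ==⇒≡ {i = i} {j} i==j
    in λ eq → bip a b (proj₁ (∧-true {adj G a b} ab))
                      (flipBy-injective i (trans eq (cong (λ k → flipBy k (side b)) (sym i≡j))))
  ... | inj₂ cross =
    let i≠j , a==b = ∧-true {not (i == j)} cross in
    subst (λ c → flipBy i (side a) ≢ flipBy j (side c)) (==⇒≡ (proj₁ (∧-true {a == b} a==b)))
          (flipBy-≢ (not-==⇒≢ {i = i} {j} i≠j) (side a))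

  vertexOf : Fin (n G * 2) → Fin (n G)
  vertexOf p = proj₁ (remQuot {n G} 2 p)

  layerOf : Fin (n G * 2) → Fin 2
  layerOf p = proj₂ (remQuot {n G} 2 p)

  layeredGraph : Σ Graph Bipartite
  layeredGraph = bipartiteGraph (λ p q → layeredAdj (remQuot 2 p) (remQuot 2 q))
    (λ p q → layeredAdj-sym (remQuot 2 p) (remQuot 2 q)) (layeredSide ∘ remQuot 2)
    (λ p q → layeredAdj-bip (remQuot 2 p) (remQuot 2 q))

  H : Graph
  H = proj₁ layeredGraph

  node : Fin (n G) → Fin 2 → Fin (n H)
  node = combine

  H-adj-node : ∀ v i w j → adj H (node v i) (node w j) ≡ layeredAdj (v , i) (w , j)
  H-adj-node v i w j = cong₂ layeredAdj (remQuot-combine v i) (remQuot-combine w j)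

  capacity : ∀ v → ⌈ degree G v /2⌉ + (if short v then 1 else 0) ≤ r
  capacity v with short v in is-short
  ... | true = ≤-reflexive (begin
    ⌈ degree G v /2⌉ + 1   ≡⟨ +-comm _ 1 ⟩
    suc ⌈ degree G v /2⌉   ≡⟨ ⌈d+2/2⌉≡1+⌈d/2⌉ (degree G v) ⟨
    ⌈ degree G v + 2 /2⌉   ≡⟨ cong ⌈_/2⌉ (does⇒ (degree G v + 2 ≟ r * 2) is-short) ⟩
    ⌈ r * 2 /2⌉            ≡⟨ ⌈r*2/2⌉≡r r ⟩
    r                      ∎)
    where open ≡-Reasoning
  ... | false = begin
    ⌈ degree G v /2⌉ + 0   ≡⟨ +-identityʳ _ ⟩
    ⌈ degree G v /2⌉       ≤⟨ ⌈n/2⌉-mono (admissible⇒≤ r (admissible v)) ⟩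
    ⌈ r * 2 /2⌉            ≡⟨ ⌈r*2/2⌉≡r r ⟩
    r                      ∎
    where open ≤-Reasoning

  H-degree : ∀ p → degree H p ≤ r
  H-degree p = begin
    count (adj H p)                                  ≤⟨ count-∨ same-layer cross ⟩
    count same-layer + count cross                   ≤⟨ +-mono-≤ same-layer≤ cross≤ ⟩
    ⌈ degree G a /2⌉ + (if short a then 1 else 0)    ≤⟨ capacity a ⟩
    r                                                ∎
    where
    open ≤-Reasoning
    a = vertexOf p
    i = layerOf p
    same-layer cross : Fin (n H) → Bool
    same-layer q = i == layerOf q ∧ adj G a (vertexOf q) ∧ label a (vertexOf q) == i
    cross      q = not (i == layerOf q) ∧ a == vertexOf q ∧ short a
    same-layer-elim : ∀ q → same-layer q ≡ true →
      layerOf q ≡ i × (adj G a (vertexOf q) ∧ label a (vertexOf q) == i) ≡ true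
    same-layer-elim q s = let i==j , edge = ∧-true {i == layerOf q} s in sym (==⇒≡ {i = i} i==j) , edge
    cross-elim : ∀ q → cross q ≡ true → layerOf q ≢ i × vertexOf q ≡ a
    cross-elim q c = let i≠j , rest = ∧-true {not (i == layerOf q)} c in
      not-==⇒≢ {i = i} i≠j ∘ sym , sym (==⇒≡ {i = a} (proj₁ (∧-true {a == vertexOf q} rest)))
    node-injective : ∀ {q q'} → vertexOf q ≡ vertexOf q' → layerOf q ≡ layerOf q' → q ≡ q'
    node-injective {q} {q'} v≡ l≡ =
      trans (sym (combine-remQuot {n G} 2 q)) (trans (cong₂ combine v≡ l≡) (combine-remQuot {n G} 2 q'))
    same-layer≤ : count same-layer ≤ ⌈ degree G a /2⌉
    same-layer≤ = ≤-trans
      (count-injection same-layer (λ w → adj G a w ∧ label a w == i) (λ q _ → vertexOf q)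
        (λ q s → proj₂ (same-layer-elim q s))
        λ {q} {q'} s s' eq →
          node-injective eq (trans (proj₁ (same-layer-elim q s)) (sym (proj₁ (same-layer-elim q' s')))))
      (proj₂ balanced a i)
    cross≤1 : count cross ≤ 1
    cross≤1 = ≤-trans
      (count-injection cross (λ (_ : Fin 1) → true) (λ _ _ → zero) (λ _ _ → refl)
        λ {q} {q'} c c' _ → node-injective (trans (proj₂ (cross-elim q c)) (sym (proj₂ (cross-elim q' c'))))
                                           (Fin2-≢⇒≡ (proj₁ (cross-elim q c)) (proj₁ (cross-elim q' c'))))
      (≤-reflexive (count-true {1}))
    cross≤ : count cross ≤ (if short a then 1 else 0)
    cross≤ = by-shortness (short a) refl
      where
      by-shortness : ∀ b → short a ≡ b → count cross ≤ (if b then 1 else 0)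
      by-shortness true  _         = cross≤1
      by-shortness false not-short = ≤-reflexive (trans (count-cong no-cross) (count-false {n H}))
        where
        no-cross : ∀ q → cross q ≡ false
        no-cross q = trans (cong (λ s → not (i == layerOf q) ∧ a == vertexOf q ∧ s) not-short)
                           (trans (cong (not (i == layerOf q) ∧_) (∧-zeroʳ (a == vertexOf q))) (∧-zeroʳ _))

  private
    H-colouring = konig H (proj₂ layeredGraph) r H-degree

  h : EdgeColouring H r
  h = proj₁ H-colouring

  private
    h-sym = proj₁ (proj₂ H-colouring)
    h-inj = proj₂ (proj₂ H-colouring)

  H-edge : ∀ {v w i} → adj G v w ≡ true → label v w ≡ i → adj H (node v i) (node w i) ≡ true
  H-edge {v} {w} vw refl = trans (H-adj-node v l w l)
    (cong (_∨ (not (l == l) ∧ v == w ∧ short v)) (∧-intro (==-refl l) (∧-intro vw (==-refl l))))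
    where l = label v w

  H-hole : ∀ {v i j} → short v ≡ true → i ≢ j → adj H (node v i) (node v j) ≡ true
  H-hole {v} {i} {j} is-short i≢j rewrite H-adj-node v i v j | ≢⇒== i≢j | ==-refl v | is-short = refl

  -- The colour of vw is 2p + i, where p is the H-colour of vw and i its label.
  colour : EdgeColouring G (r * 2)
  colour v w = combine (h (node v (label v w)) (node w (label v w))) (label v w)

  colour-decode : ∀ {v w c i} → colour v w ≡ combine c i → label v w ≡ i × h (node v i) (node w i) ≡ c
  colour-decode {v} {w} {c} eq = let h≡c , l≡i = combine-injective _ _ _ _ eq in
    l≡i , subst (λ j → h (node v j) (node w j) ≡ c) l≡i h≡c

  colour-proper : IsProper G colour
  colour-proper = colour-sym , colour-inj
    where
    colour-sym : ∀ {v w} → adj G v w ≡ true → colour v w ≡ colour w v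
    colour-sym {v} {w} vw = begin
      combine (h (node v l) (node w l)) l ≡⟨ cong (λ c → combine c l) (h-sym (H-edge vw refl)) ⟩
      combine (h (node w l) (node v l)) l ≡⟨ cong (λ j → combine (h (node w j) (node v j)) j) (label-sym vw) ⟩
      colour w v                          ∎
      where
      open ≡-Reasoning
      l = label v w
    colour-inj : ∀ {v w w'} → adj G v w ≡ true → adj G v w' ≡ true → colour v w ≡ colour v w' → w ≡ w'
    colour-inj {v} {w} {w'} vw vw' eq = let l≡ , h≡ = colour-decode eq in
      combine-injectiveˡ w _ w' _ (h-inj (H-edge vw l≡) (H-edge vw' refl) h≡)

  hole-missing : ∀ {v i j} → short v ≡ true → i ≢ j → Missing G colour v (combine (h (node v i) (node v j)) i)
  hole-missing {v} {i} {j} is-short i≢j {w} vw eq = let l≡ , h≡ = colour-decode eq in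
    i≢j (combine-injectiveʳ w i v j (h-inj (H-edge vw l≡) (H-hole is-short i≢j) h≡))

  absent-count : ∀ {v k} → degree G v + k ≡ r * 2 → count (not ∘ present G colour v) ≡ k
  absent-count {v} {k} eq = +-cancelˡ-≡ (degree G v) _ k (trans (degree+absent G colour colour-proper v) (sym eq))

  -- A short vertex v misses 2p and 2p + 1, where p is the H-colour of the edge joining the copies of v.
  short-cyclic : ∀ {v} → degree G v + 2 ≡ r * 2 → IsCyclicInterval (r * 2) (ColoursAt G (colourNumber G colour) v)
  short-cyclic {v} d+2≡ = cyclic-if-absent-consecutive G colour colour-proper v
    (≤-reflexive (absent-count d+2≡)) (hole-missing is-short 0≢1) hole₁-missing consecutive
    where
    is-short = dec-true (degree G v + 2 ≟ r * 2) d+2≡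
    0≢1 = 0≢1+n {i = zero}
    hole = h (node v zero) (node v (suc zero))
    hole₁-missing : Missing G colour v (combine hole (suc zero))
    hole₁-missing = subst (λ c → Missing G colour v (combine c (suc zero))) (sym (h-sym (H-hole is-short 0≢1)))
                          (hole-missing is-short (0≢1 ∘ sym))
    consecutive : toℕ (combine hole (suc zero)) ≡ suc (toℕ (combine hole zero))
    consecutive = trans (toℕ-combine hole (suc zero)) (trans (+-suc _ 0) (cong suc (sym (toℕ-combine hole zero))))

  vertex-cyclic : ∀ v → IsCyclicInterval (r * 2) (ColoursAt G (colourNumber G colour) v)
  vertex-cyclic v with admissible v
  ... | inj₁ d≡1 =
    cyclic-if-present-≤1 G colour colour-proper v (≤-reflexive (trans (count-present G colour colour-proper v) d≡1))
  ... | inj₂ (inj₁ d+2≡) = short-cyclic d+2≡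
  ... | inj₂ (inj₂ (inj₁ d+1≡)) =
    cyclic-if-absent-≤1 G colour colour-proper v (≤-reflexive (absent-count d+1≡))
  ... | inj₂ (inj₂ (inj₂ d≡)) =
    cyclic-if-absent-≤1 G colour colour-proper v
      (≤-trans (≤-reflexive (absent-count (trans (+-identityʳ _) d≡))) z≤n)

cyclicIntervalColourable : (r : ℕ) .{{_ : NonZero r}} (G : Graph) → Bipartite G →
  (∀ v → AdmissibleDegree r (degree G v)) → HasCyclicIntervalColouring G
cyclicIntervalColourable r G (side , bip) admissible =
  r * 2 , colourNumber G colour , cyclicIntervalColouring G colour colour-proper vertex-cyclic
  where open Construction G side bip (proj₂ (balancedLabelling G (side , bip))) r admissible

-- Attaching pendant edges

↑-cases : ∀ m {k} (P : Fin (m + k) → Set) → (∀ u → P (u ↑ˡ k)) → (∀ j → P (m ↑ʳ j)) → ∀ x → P x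
↑-cases m {k} P left right x = subst P (join-splitAt m k x) (by-side (splitAt m x))
  where
  by-side : ∀ s → P (join m k s)
  by-side (inj₁ u) = left u
  by-side (inj₂ j) = right j

enum : (P : Fin m → Bool) → Fin (count P) → Fin m
enum {suc m} P i with P zero
enum {suc m} P zero    | true  = zero
enum {suc m} P (suc i) | true  = suc (enum (P ∘ suc) i)
enum {suc m} P i       | false = suc (enum (P ∘ suc) i)

enum-fibre : (P : Fin m → Bool) (x : Fin m) → count (λ i → enum P i == x) ≡ (if P x then 1 else 0)
enum-fibre {suc m} P x with P zero in P0
enum-fibre {suc m} P zero    | true  =
  trans (cong suc (count-false {count (P ∘ suc)})) (cong (λ b → if b then 1 else 0) (sym P0))
enum-fibre {suc m} P (suc x) | true  = enum-fibre (P ∘ suc) x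
enum-fibre {suc m} P zero    | false =
  trans (count-false {count (P ∘ suc)}) (cong (λ b → if b then 1 else 0) (sym P0))
enum-fibre {suc m} P (suc x) | false = enum-fibre (P ∘ suc) x

module _ (G : Graph) (k : ℕ) (f : Fin k → Fin (n G)) where

  pendantAdj : Fin (n G) ⊎ Fin k → Fin (n G) ⊎ Fin k → Bool
  pendantAdj (inj₁ u) (inj₁ v) = adj G u v
  pendantAdj (inj₁ u) (inj₂ j) = f j == u
  pendantAdj (inj₂ j) (inj₁ u) = f j == u
  pendantAdj (inj₂ i) (inj₂ j) = false

  attachPendant-adj-splitAt : ∀ x y →
    adj (attachPendant G k f) x y ≡ pendantAdj (splitAt (n G) x) (splitAt (n G) y)
  attachPendant-adj-splitAt x y with splitAt (n G) x | splitAt (n G) y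
  ... | inj₁ u | inj₁ v = refl
  ... | inj₁ u | inj₂ j = refl
  ... | inj₂ j | inj₁ u = refl
  ... | inj₂ i | inj₂ j = refl

  attachPendant-adj : ∀ s t → adj (attachPendant G k f) (join (n G) k s) (join (n G) k t) ≡ pendantAdj s t
  attachPendant-adj s t = trans (attachPendant-adj-splitAt (join (n G) k s) (join (n G) k t))
                                (cong₂ pendantAdj (splitAt-join (n G) k s) (splitAt-join (n G) k t))

  attachPendant-degree : ∀ s → degree (attachPendant G k f) (join (n G) k s) ≡
    count (λ w → pendantAdj s (inj₁ w)) + count (λ j → pendantAdj s (inj₂ j))
  attachPendant-degree s = trans (count-↑ (n G) _)
    (cong₂ _+_ (count-cong λ w → attachPendant-adj s (inj₁ w)) (count-cong λ j → attachPendant-adj s (inj₂ j)))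

  degree-old : ∀ u → degree (attachPendant G k f) (u ↑ˡ k) ≡ degree G u + count (λ j → f j == u)
  degree-old u = attachPendant-degree (inj₁ u)

  degree-new : ∀ j → degree (attachPendant G k f) (n G ↑ʳ j) ≡ 1
  degree-new j = trans (attachPendant-degree (inj₂ j)) (cong₂ _+_ (count-singleton (f j)) (count-false {k}))

  attachPendant-bipartite : Bipartite G → Bipartite (attachPendant G k f)
  attachPendant-bipartite (side , bip) = side′ ∘ splitAt (n G) , λ x y xy →
    bip′ (splitAt (n G) x) (splitAt (n G) y) (trans (sym (attachPendant-adj-splitAt x y)) xy)
    where
    side′ : Fin (n G) ⊎ Fin k → Bool
    side′ (inj₁ u) = side u
    side′ (inj₂ j) = not (side (f j))
    bip′ : ∀ s t → pendantAdj s t ≡ true → side′ s ≢ side′ t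
    bip′ (inj₁ u) (inj₁ v) uv = bip u v uv
    bip′ (inj₁ u) (inj₂ j) e  = not-¬ (cong side (sym (==⇒≡ e)))
    bip′ (inj₂ j) (inj₁ u) e  = not-¬ (cong side (sym (==⇒≡ e))) ∘ sym

module _ (r : ℕ) (2≤r : 2 ≤ r) where

  3≤2r : 3 ≤ 2 * r
  3≤2r = ≤-trans (s≤s (s≤s (s≤s z≤n))) (*-monoʳ-≤ 2 2≤r)

  deficit : ∀ {d m} → m ≤ 2 * r → d ≡ 2 * r ∸ m → d + m ≡ r * 2
  deficit {d} {m} m≤2r refl = trans (m∸n+n≡m m≤2r) (*-comm 2 r)

  not-low : ∀ {d m} → d + m ≡ r * 2 → m ≢ 3 → d ≢ 2 * r ∸ 3
  not-low {d} {m} d+m≡ m≢3 d≡ = m≢3 (+-cancelˡ-≡ d m 3 (trans d+m≡ (sym (deficit 3≤2r d≡))))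

  unchanged : ∀ {d m} → d + m ≡ r * 2 → m ≢ 3 → AdmissibleDegree r d →
    AdmissibleDegree r (d + (if does (d ≟ 2 * r ∸ 3) then 1 else 0))
  unchanged {d} d+m≡ m≢3 admissible rewrite dec-false (d ≟ 2 * r ∸ 3) (not-low d+m≡ m≢3) | +-identityʳ d =
    admissible

  admissible-after-pendant : ∀ d → d ≡ 2 * r ∸ 3 ⊎ d ≡ 2 * r ∸ 2 ⊎ d ≡ 2 * r ∸ 1 ⊎ d ≡ 2 * r →
    AdmissibleDegree r (d + (if does (d ≟ 2 * r ∸ 3) then 1 else 0))
  admissible-after-pendant d (inj₁ d≡) rewrite dec-true (d ≟ 2 * r ∸ 3) d≡ =
    inj₂ (inj₁ (trans (+-assoc d 1 2) (deficit 3≤2r d≡)))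
  admissible-after-pendant d (inj₂ (inj₁ d≡)) = unchanged d+2≡ (λ ()) (inj₂ (inj₁ d+2≡))
    where d+2≡ = deficit (≤-trans (s≤s (s≤s z≤n)) 3≤2r) d≡
  admissible-after-pendant d (inj₂ (inj₂ (inj₁ d≡))) = unchanged d+1≡ (λ ()) (inj₂ (inj₂ (inj₁ d+1≡)))
    where d+1≡ = deficit (≤-trans (s≤s z≤n) 3≤2r) d≡
  admissible-after-pendant d (inj₂ (inj₂ (inj₂ d≡))) =
    unchanged (deficit z≤n d≡) (λ ()) (inj₂ (inj₂ (inj₂ (trans d≡ (*-comm 2 r)))))

corollary6 : (r : ℕ) → 2 ≤ r → (G : Graph) → Bipartite G →
    (∀ v → deg G v ≡ 2 * r ∸ 3 ⊎ deg G v ≡ 2 * r ∸ 2 ⊎ deg G v ≡ 2 * r ∸ 1 ⊎ deg G v ≡ 2 * r) →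
    DefcAtMost G (countDeg G (2 * r ∸ 3))
corollary6 r 2≤r G bipartite degrees =
  count low , ≤-reflexive (sym (length-filter-tabulate (λ v → deg G v ≟ 2 * r ∸ 3) id)) , enum low ,
  cyclicIntervalColourable r {{>-nonZero (≤-trans (s≤s z≤n) 2≤r)}} G′
    (attachPendant-bipartite G (count low) (enum low) bipartite) admissible
  where
  low : Fin (n G) → Bool
  low v = does (deg G v ≟ 2 * r ∸ 3)
  G′ : Graph
  G′ = attachPendant G (count low) (enum low)
  old-degree : ∀ u → deg G u + (if low u then 1 else 0) ≡ degree G′ (u ↑ˡ count low)
  old-degree u = sym (trans (degree-old G (count low) (enum low) u)
                            (cong₂ _+_ (sym (deg≡degree G u)) (enum-fibre low u)))
  admissible : ∀ x → AdmissibleDegree r (degree G′ x)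
  admissible = ↑-cases (n G) (AdmissibleDegree r ∘ degree G′)
    (λ u → subst (AdmissibleDegree r) (old-degree u) (admissible-after-pendant r 2≤r (deg G u) (degrees u)))
    (λ j → subst (AdmissibleDegree r) (sym (degree-new G (count low) (enum low) j)) (inj₁ refl))
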